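{- Every coideal $\mathcal{H}$ with the Fréchet–Urysohn property is semiselective.
   Context: $\mathbb{N}=\{0,1,2,\dots\}$; $A^{[\infty]}$ is the set of infinite subsets of $A$; $A/n=\{m\in A:m>n\}$. A coideal is $\mathcal{H}\subseteq\wp(\mathbb{N})$, $\mathcal{H}\neq\wp(\mathbb{N})$, upward closed and with $A\cup B\in\mathcal{H}\Rightarrow A\in\mathcal{H}$ or $B\in\mathcal{H}$. $\mathcal{H}$ has the Fréchet–Urysohn property if for every $A\in\mathcal{H}$ there is $B\in A^{[\infty]}$ with $B^{[\infty]}\subseteq\mathcal{H}$. $D\subseteq\mathcal{H}$ is dense open in $(\mathcal{H},\subseteq)$ if every element of $\mathcal{H}$ has a subset in $D$ and $D$ is closed under subsets lying in $\mathcal{H}$. $\mathcal{H}$ is semiselective if for every sequence $(D_n)_n$ of dense open subsets of $(\mathcal{H},\subseteq)$ and every $A\in\mathcal{H}$ there is $B\in\mathcal{H}$, $B\subseteq A$, with $B/n\in D_n$ for all $n\in B$. -}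

module Defs where

open import Level using (0ℓ)
open import Data.Nat using (ℕ; _<_)
open import Data.Product using (_×_; ∃-syntax)
open import Data.Sum using (_⊎_)
open import Relation.Nullary using (¬_)
open import Relation.Unary using (Pred; _∈_; _⊆_; _∪_)

Subset : Set₁
Subset = Pred ℕ 0ℓ

Family : Set₁
Family = Pred Subset 0ℓ

Infinite : Subset → Set
Infinite A = ∀ n → ∃[ m ] (n < m × m ∈ A)

_/_ : Subset → ℕ → Subset
(A / n) m = m ∈ A × n < m

record IsCoideal (H : Family) : Set₁ where
  field
    proper     : ¬ (∀ (A : Subset) → A ∈ H)
    upward     : ∀ {A B : Subset} → A ⊆ B → A ∈ H → B ∈ H
    partition  : ∀ (A B : Subset) → (A ∪ B) ∈ H → A ∈ H ⊎ B ∈ H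

FrechetUrysohn : Family → Set₁
FrechetUrysohn H =
  ∀ (A : Subset) → A ∈ H →
    ∃[ B ] (B ⊆ A × Infinite B × (∀ (C : Subset) → C ⊆ B → Infinite C → C ∈ H))

DenseOpen : Family → Family → Set₁
DenseOpen H D =
  D ⊆ H
  × (∀ (A : Subset) → A ∈ H → ∃[ B ] (B ⊆ A × B ∈ D))
  × (∀ (A B : Subset) → A ∈ D → B ⊆ A → B ∈ H → B ∈ D)

Semiselective : Family → Set₁
Semiselective H =
  ∀ (D : ℕ → Family) → (∀ n → DenseOpen H (D n)) →
  ∀ (A : Subset) → A ∈ H →
    ∃[ B ] (B ∈ H × B ⊆ A × (∀ n → n ∈ B → (B / n) ∈ D n))

-- Shrink A ∈ H to some A′ whose infinite subsets all lie in H.  Inside A′ pick a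
-- ⊆-decreasing chain X₀ ⊇ X₁ ⊇ … in H with X (n + 1) ∈ D n (density), then a
-- diagonal set B = {b₀ < b₁ < …} with b (k + 1) ∈ X (b k + 1).  For n ∈ B the tail
-- B / n is an infinite subset of A′, hence in H, and lies inside X (n + 1) ∈ D n,
-- so it is in D n because D n is open.
module Submission where

open import Defs
open import Data.Nat using (ℕ; zero; suc; _+_; _≤_; _<_; _≤′_; z≤n; s≤s; ≤′-refl; ≤′-step)
open import Data.Nat.Properties
  using (≤-refl; ≤-trans; <⇒≤; <⇒≱; ≰⇒>; ≤-<-trans; ≤⇒≤′; m≤m+n; m≤n+m)
open import Data.Product using (Σ; _×_; ∃-syntax; _,_; proj₁; proj₂)
open import Function using (id)
open import Relation.Unary using (_∈_; _⊆_)
open import Relation.Binary.PropositionalEquality using (_≡_; refl)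

private
  variable
    k l : ℕ

Infinite-/ : ∀ {B : Subset} → Infinite B → ∀ n → Infinite (B / n)
Infinite-/ B-infinite n m =
  let (x , n+m<x , x∈B) = B-infinite (m + n)
  in x , ≤-<-trans (m≤m+n m n) n+m<x , x∈B , ≤-<-trans (m≤n+m n m) n+m<x

FrechetUrysohn⇒Infinite : ∀ {H : Family} → FrechetUrysohn H → ∀ {A} → A ∈ H → Infinite A
FrechetUrysohn⇒Infinite FU {A} A∈H n =
  let (B , B⊆A , B-infinite , _) = FU A A∈H
      (m , n<m , m∈B) = B-infinite n
  in m , n<m , B⊆A m∈B

module _ {f : ℕ → ℕ} (f-step : ∀ k → f k < f (suc k)) where

  increasing-≤ : k ≤ l → f k ≤ f l
  increasing-≤ k≤l = go (≤⇒≤′ k≤l)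
    where
    go : k ≤′ l → f k ≤ f l
    go ≤′-refl        = ≤-refl
    go (≤′-step k≤′l) = ≤-trans (go k≤′l) (<⇒≤ (f-step _))

  increasing-reflects-< : f k < f l → k < l
  increasing-reflects-< fk<fl = ≰⇒> (λ l≤k → <⇒≱ fk<fl (increasing-≤ l≤k))

  increasing-≥-id : ∀ k → k ≤ f k
  increasing-≥-id zero    = z≤n
  increasing-≥-id (suc k) = ≤-trans (s≤s (increasing-≥-id k)) (f-step k)

module _ {X : ℕ → Subset} (X-decreasing : ∀ n → X (suc n) ⊆ X n) where

  decreasing-⊆ : k ≤ l → X l ⊆ X k
  decreasing-⊆ k≤l = go (≤⇒≤′ k≤l)
    where
    go : k ≤′ l → X l ⊆ X k
    go ≤′-refl        = id
    go (≤′-step k≤′l) = λ x∈X → go k≤′l (X-decreasing _ x∈X)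

  diagonal : (∀ n → Infinite (X n)) →
             ∃[ B ] (B ⊆ X 0 × Infinite B × (∀ n → n ∈ B → B / n ⊆ X (suc n)))
  diagonal X-infinite = B , B⊆X₀ , B-infinite , B/n⊆X
    where
    b : ℕ → ℕ
    b zero    = proj₁ (X-infinite 0 0)
    b (suc k) = proj₁ (X-infinite (suc (b k)) (b k))

    b-step : ∀ k → b k < b (suc k)
    b-step k = proj₁ (proj₂ (X-infinite (suc (b k)) (b k)))

    b-next : ∀ k → b (suc k) ∈ X (suc (b k))
    b-next k = proj₂ (proj₂ (X-infinite (suc (b k)) (b k)))

    b-later : k < l → b l ∈ X (suc (b k))
    b-later {l = suc l} (s≤s k≤l) = decreasing-⊆ (s≤s (increasing-≤ b-step k≤l)) (b-next l)

    B : Subset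
    B m = ∃[ k ] b k ≡ m

    B⊆X₀ : B ⊆ X 0
    B⊆X₀ (zero  , refl) = proj₂ (proj₂ (X-infinite 0 0))
    B⊆X₀ (suc k , refl) = decreasing-⊆ z≤n (b-next k)

    B-infinite : Infinite B
    B-infinite n = b (suc n) , ≤-<-trans (increasing-≥-id b-step n) (b-step n) , suc n , refl

    B/n⊆X : ∀ n → n ∈ B → B / n ⊆ X (suc n)
    B/n⊆X _ (k , refl) ((l , refl) , bk<bl) = b-later (increasing-reflects-< b-step {k} {l} bk<bl)

module _ {H : Family} {D : ℕ → Family} (D-denseOpen : ∀ n → DenseOpen H (D n)) where

  DenseOpen-chain : ∀ {A} → A ∈ H →
    ∃[ X ] (X 0 ⊆ A × (∀ n → X n ∈ H) × (∀ n → X (suc n) ⊆ X n) × (∀ n → X (suc n) ∈ D n))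
  DenseOpen-chain {A} A∈H = X , id , X∈H , X-decreasing , X∈D
    where
    shrink : ∀ n {Y} → Y ∈ H → ∃[ Z ] (Z ⊆ Y × Z ∈ D n)
    shrink n {Y} = proj₁ (proj₂ (D-denseOpen n)) Y

    chain : ℕ → Σ Subset (_∈ H)
    chain zero    = A , A∈H
    chain (suc n) = let (Z , _ , Z∈D) = shrink n (proj₂ (chain n))
                    in Z , proj₁ (D-denseOpen n) Z∈D

    X : ℕ → Subset
    X n = proj₁ (chain n)

    X∈H : ∀ n → X n ∈ H
    X∈H n = proj₂ (chain n)

    X-decreasing : ∀ n → X (suc n) ⊆ X n
    X-decreasing n = proj₁ (proj₂ (shrink n (X∈H n)))

    X∈D : ∀ n → X (suc n) ∈ D n
    X∈D n = proj₂ (proj₂ (shrink n (X∈H n)))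

proposition5p3 : ∀ (H : Family) → IsCoideal H → FrechetUrysohn H → Semiselective H
proposition5p3 H _ FU D D-denseOpen A A∈H
  with FU A A∈H
... | A′ , A′⊆A , A′-infinite , A′-hereditary
  with DenseOpen-chain D-denseOpen (A′-hereditary A′ id A′-infinite)
... | X , X₀⊆A′ , X∈H , X-decreasing , X∈D
  with diagonal X-decreasing (λ n → FrechetUrysohn⇒Infinite FU (X∈H n))
... | B , B⊆X₀ , B-infinite , B/n⊆X
  = B , A′-hereditary B B⊆A′ B-infinite , (λ x∈B → A′⊆A (B⊆A′ x∈B)) , B/n∈D
  where
  B⊆A′ : B ⊆ A′
  B⊆A′ x∈B = X₀⊆A′ (B⊆X₀ x∈B)

  B/n∈D : ∀ n → n ∈ B → B / n ∈ D n
  B/n∈D n n∈B =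
    let (_ , _ , D-open) = D-denseOpen n
    in D-open (X (suc n)) (B / n) (X∈D n) (B/n⊆X n n∈B)
         (A′-hereditary (B / n) (λ x∈B/n → B⊆A′ (proj₁ x∈B/n)) (Infinite-/ B-infinite n))
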